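{- Let $P_n$ be the path on $n$ vertices. For $n\geq 1$, $\operatorname{zir}(P_n)=\operatorname{Z}(P_n)=1$. For $n\geq 4$, $\overline{\operatorname{Z}}(P_n)=2$. For $n\geq 5$, $\operatorname{ZIR}(P_n)=\lfloor (n-1)/2\rfloor$.
   Context: All graphs are simple, undirected, finite. Zero forcing: from a set $B$ of blue vertices, a blue vertex $u$ may turn a white vertex $w$ blue if $w$ is the only white neighbor of $u$; $B$ is a zero forcing set if eventually all vertices are blue. $\operatorname{Z}(G)$ is the minimum size of a zero forcing set; $\overline{\operatorname{Z}}(G)$ is the maximum size of an inclusion-minimal zero forcing set. A fort is a nonempty $F\subseteq V(G)$ such that every $v\notin F$ has $|F\cap N(v)|\neq 1$. For $S\subseteq V(G)$, $x\in S$, a private fort of $x$ relative to $S$ is a fort $F$ with $S\cap F=\{x\}$; $S$ is a ZIr-set if every element has a private fort. $\operatorname{zir}(G)$ and $\operatorname{ZIR}(G)$ are the minimum and maximum cardinality of an inclusion-maximal ZIr-set of $G$. -}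

module Defs where

open import Data.Nat using (ℕ; zero; suc; _+_; _≤_; _≡ᵇ_)
open import Data.Bool using (Bool; true; false; _∨_)
open import Data.Bool.Properties using (∨-comm)
open import Data.Fin using (Fin; toℕ; _≟_)
open import Data.Fin.Subset using (Subset; _∈_; _∉_; _⊆_; _⊂_; _∩_; _∪_; ⁅_⁆; ∣_∣; ⊤; Nonempty)
open import Data.Vec using (tabulate)
open import Data.Product using (Σ; ∃; _×_; _,_)
open import Relation.Binary.PropositionalEquality using (_≡_; _≢_; refl)
open import Relation.Binary.Construct.Closure.ReflexiveTransitive using (Star)
open import Relation.Nullary using (¬_)

record Graph (n : ℕ) : Set where
  field
    adj   : Fin n → Fin n → Bool
    sym   : ∀ u v → adj u v ≡ adj v u
    irrefl : ∀ v → adj v v ≡ false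

open Graph public

Adj : ∀ {n} → Graph n → Fin n → Fin n → Set
Adj G u v = adj G u v ≡ true

N : ∀ {n} → Graph n → Fin n → Subset n
N G v = tabulate (adj G v)

pathAdj : ∀ {n} → Fin n → Fin n → Bool
pathAdj i j = ((toℕ i + 1) ≡ᵇ toℕ j) ∨ ((toℕ j + 1) ≡ᵇ toℕ i)

private
  k+1≢ᵇk : ∀ k → ((k + 1) ≡ᵇ k) ≡ false
  k+1≢ᵇk zero = refl
  k+1≢ᵇk (suc k) = k+1≢ᵇk k

  pathSym : ∀ {n} (i j : Fin n) → pathAdj i j ≡ pathAdj j i
  pathSym i j = ∨-comm ((toℕ i + 1) ≡ᵇ toℕ j) ((toℕ j + 1) ≡ᵇ toℕ i)

  pathIrrefl : ∀ {n} (i : Fin n) → pathAdj i i ≡ false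
  pathIrrefl i rewrite k+1≢ᵇk (toℕ i) = refl

P : (n : ℕ) → Graph n
P n = record { adj = pathAdj ; sym = pathSym ; irrefl = pathIrrefl }

Force : ∀ {n} → Graph n → Subset n → Subset n → Set
Force {n} G B B' =
  Σ (Fin n) λ u → Σ (Fin n) λ w →
    u ∈ B × w ∉ B × Adj G u w
    × (∀ v → Adj G u v → v ≢ w → v ∈ B)
    × B' ≡ B ∪ ⁅ w ⁆

ZFS : ∀ {n} → Graph n → Subset n → Set
ZFS G B = Star (Force G) B ⊤

MinimalZFS : ∀ {n} → Graph n → Subset n → Set
MinimalZFS G B = ZFS G B × (∀ B' → B' ⊂ B → ¬ ZFS G B')

Fort : ∀ {n} → Graph n → Subset n → Set
Fort G F = Nonempty F × (∀ v → v ∉ F → ∣ F ∩ N G v ∣ ≢ 1)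

PrivateFort : ∀ {n} → Graph n → Subset n → Fin n → Subset n → Set
PrivateFort G S x F = Fort G F × S ∩ F ≡ ⁅ x ⁆

ZIr : ∀ {n} → Graph n → Subset n → Set
ZIr G S = ∀ x → x ∈ S → ∃ (PrivateFort G S x)

MaximalZIr : ∀ {n} → Graph n → Subset n → Set
MaximalZIr G S = ZIr G S × (∀ T → S ⊂ T → ¬ ZIr G T)

IsMinCard : ∀ {n} → (Subset n → Set) → ℕ → Set
IsMinCard {n} Q k = (Σ (Subset n) λ S → Q S × ∣ S ∣ ≡ k) × (∀ S → Q S → k ≤ ∣ S ∣)

IsMaxCard : ∀ {n} → (Subset n → Set) → ℕ → Set
IsMaxCard {n} Q k = (Σ (Subset n) λ S → Q S × ∣ S ∣ ≡ k) × (∀ S → Q S → ∣ S ∣ ≤ k)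

Z≡ : ∀ {n} → Graph n → ℕ → Set
Z≡ G k = IsMinCard (ZFS G) k

Zbar≡ : ∀ {n} → Graph n → ℕ → Set
Zbar≡ G k = IsMaxCard (MinimalZFS G) k

zir≡ : ∀ {n} → Graph n → ℕ → Set
zir≡ G k = IsMinCard (MaximalZIr G) k

ZIR≡ : ∀ {n} → Graph n → ℕ → Set
ZIR≡ G k = IsMaxCard (MaximalZIr G) k

{-# OPTIONS --safe #-}

-- A vertex outside a fort never has exactly one neighbour inside it.  On a path this means that
-- next to two consecutive vertices outside a fort the vacancy continues, so an end vertex outside a
-- fort would empty it and an edge outside a fort would leave the last vertex outside.  Hence every
-- fort of P n contains both end vertices and an end of every edge, so a ZIr-set containing an end
-- vertex is a singleton, one containing an edge has at most two elements, and one with three or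
-- more elements is an independent set avoiding both ends, hence has at most ⌊(n − 1)/2⌋ elements.
-- The odd interior vertices attain the bound; the private fort of each of them is the complement
-- of the set together with that vertex.
-- Dually, the vertex making the first force is an end vertex or has its other neighbour blue, so
-- every zero forcing set contains an end vertex or an edge.  Both of these are zero forcing (the
-- blue interval grows outward one vertex at a time), so inclusion-minimal zero forcing sets have at
-- most two elements, and {1, 2} is one of them once n ≥ 4.

module Submission where

open import Defs hiding (sym)
open import Data.Nat using (ℕ; zero; suc; pred; _+_; _*_; _∸_; _≤_; _<_; z≤n; s≤s; _≤ᵇ_; _≤?_; _/_)
open import Data.Nat.Properties
open import Data.Nat.DivMod using (/-monoˡ-≤; m*n/n≡m; m/n≡1+[m∸n]/n)
open import Data.Bool using (Bool; true; _∧_)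
open import Data.Bool.Properties using (T-≡; T-∧; T-∨)
open import Data.Fin using (Fin; zero; suc; toℕ; fromℕ; fromℕ<; inject₁)
open import Data.Fin.Properties using (toℕ-injective; toℕ-fromℕ; toℕ-fromℕ<; toℕ-inject₁; toℕ<n)
open import Data.Fin.Subset
  using (Subset; inside; outside; _∈_; _∉_; _⊆_; _⊂_; _∩_; _∪_; ∁; ⁅_⁆; ∣_∣; ⊤; Nonempty)
open import Data.Fin.Subset.Properties
open import Data.Vec using (_∷_; []; here; there; tabulate)
open import Data.Vec.Properties using (lookup∘tabulate; []=⇒lookup; lookup⇒[]=)
open import Data.Product using (∃; ∃₂; _×_; _,_; proj₁; proj₂)
open import Data.Sum using (_⊎_; inj₁; inj₂; [_,_])
open import Data.Empty using (⊥-elim) renaming (⊥ to False)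
open import Function using (_∘_; Equivalence)
open import Relation.Binary.PropositionalEquality
  using (_≡_; _≢_; refl; sym; trans; cong; cong₂; subst; module ≡-Reasoning)
open import Relation.Nullary using (¬_; yes; no)
open import Relation.Nullary.Decidable using (decidable-stable)
open import Relation.Binary.Construct.Closure.ReflexiveTransitive using (Star; ε; _◅_; _◅◅_)

open Equivalence using (to; from)
open ≡-Reasoning

∈-tabulate⁺ : ∀ {n} {f : Fin n → Bool} {x} → f x ≡ true → x ∈ tabulate f
∈-tabulate⁺ {f = f} {x} fx = lookup⇒[]= x (tabulate f) (trans (lookup∘tabulate f x) fx)

∈-tabulate⁻ : ∀ {n} {f : Fin n → Bool} {x} → x ∈ tabulate f → f x ≡ true
∈-tabulate⁻ {f = f} {x} x∈ = trans (sym (lookup∘tabulate f x)) ([]=⇒lookup x∈)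

x∈p⇒1≤∣p∣ : ∀ {n} {p : Subset n} {x} → x ∈ p → 1 ≤ ∣ p ∣
x∈p⇒1≤∣p∣ x∈p = ≤-trans (s≤s z≤n) (x∈p⇒∣p-x∣<∣p∣ x∈p)

x≢y⇒2≤∣p∣ : ∀ {n} {p : Subset n} {x y} → x ∈ p → y ∈ p → x ≢ y → 2 ≤ ∣ p ∣
x≢y⇒2≤∣p∣ x∈p y∈p x≢y =
  ≤-trans (s≤s (x∈p⇒1≤∣p∣ (x∈p∧x≢y⇒x∈p-y y∈p (x≢y ∘ sym)))) (x∈p⇒∣p-x∣<∣p∣ x∈p)

∣p∪q∣≤∣p∣+∣q∣ : ∀ {n} (p q : Subset n) → ∣ p ∪ q ∣ ≤ ∣ p ∣ + ∣ q ∣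
∣p∪q∣≤∣p∣+∣q∣ []            []            = z≤n
∣p∪q∣≤∣p∣+∣q∣ (outside ∷ p) (outside ∷ q) = ∣p∪q∣≤∣p∣+∣q∣ p q
∣p∪q∣≤∣p∣+∣q∣ (outside ∷ p) (inside  ∷ q) =
  subst (suc ∣ p ∪ q ∣ ≤_) (sym (+-suc ∣ p ∣ ∣ q ∣)) (s≤s (∣p∪q∣≤∣p∣+∣q∣ p q))
∣p∪q∣≤∣p∣+∣q∣ (inside  ∷ p) (outside ∷ q) = s≤s (∣p∪q∣≤∣p∣+∣q∣ p q)
∣p∪q∣≤∣p∣+∣q∣ (inside  ∷ p) (inside  ∷ q) =
  s≤s (≤-trans (∣p∪q∣≤∣p∣+∣q∣ p q) (+-monoʳ-≤ ∣ p ∣ (n≤1+n ∣ q ∣)))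

∣⁅x⁆∪⁅y⁆∣≤2 : ∀ {n} (x y : Fin n) → ∣ ⁅ x ⁆ ∪ ⁅ y ⁆ ∣ ≤ 2
∣⁅x⁆∪⁅y⁆∣≤2 x y =
  ≤-trans (∣p∪q∣≤∣p∣+∣q∣ ⁅ x ⁆ ⁅ y ⁆) (≤-reflexive (cong₂ _+_ (∣⁅x⁆∣≡1 x) (∣⁅x⁆∣≡1 y)))

∈⁅x⁆∪⁅y⁆⁻ : ∀ {n} (x y : Fin n) {z} → z ∈ ⁅ x ⁆ ∪ ⁅ y ⁆ → z ≡ x ⊎ z ≡ y
∈⁅x⁆∪⁅y⁆⁻ x y z∈ with x∈p∪q⁻ ⁅ x ⁆ ⁅ y ⁆ z∈
... | inj₁ z∈⁅x⁆ = inj₁ (x∈⁅y⁆⇒x≡y x z∈⁅x⁆)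
... | inj₂ z∈⁅y⁆ = inj₂ (x∈⁅y⁆⇒x≡y y z∈⁅y⁆)

∣⁅x⁆∪⁅y⁆∣≡2 : ∀ {n} {x y : Fin n} → x ≢ y → ∣ ⁅ x ⁆ ∪ ⁅ y ⁆ ∣ ≡ 2
∣⁅x⁆∪⁅y⁆∣≡2 {x = x} {y} x≢y = ≤-antisym (∣⁅x⁆∪⁅y⁆∣≤2 x y)
  (x≢y⇒2≤∣p∣ (x∈p∪q⁺ (inj₁ (x∈⁅x⁆ x))) (x∈p∪q⁺ (inj₂ (x∈⁅x⁆ y))) x≢y)

⁅x⁆⊆p : ∀ {n} {p : Subset n} {x} → x ∈ p → ⁅ x ⁆ ⊆ p
⁅x⁆⊆p {x = x} x∈p y∈⁅x⁆ = subst (_∈ _) (sym (x∈⁅y⁆⇒x≡y x y∈⁅x⁆)) x∈p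

⁅x⁆∪⁅y⁆⊆p : ∀ {n} {p : Subset n} {x y} → x ∈ p → y ∈ p → ⁅ x ⁆ ∪ ⁅ y ⁆ ⊆ p
⁅x⁆∪⁅y⁆⊆p {x = x} {y} x∈p y∈p z∈ with ∈⁅x⁆∪⁅y⁆⁻ x y z∈
... | inj₁ refl = x∈p
... | inj₂ refl = y∈p

p≡q∪⁅x⁆ : ∀ {n} {p q : Subset n} {x} →
          (∀ {y} → y ∈ p → y ∈ q ⊎ y ≡ x) → q ⊆ p → x ∈ p → p ≡ q ∪ ⁅ x ⁆
p≡q∪⁅x⁆ {q = q} {x} split q⊆p x∈p = ⊆-antisym ⊆∪ ∪⊆
  where
  ⊆∪ : _ ⊆ q ∪ ⁅ x ⁆
  ⊆∪ y∈p with split y∈p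
  ... | inj₁ y∈q = x∈p∪q⁺ (inj₁ y∈q)
  ... | inj₂ refl = x∈p∪q⁺ (inj₂ (x∈⁅x⁆ x))
  ∪⊆ : q ∪ ⁅ x ⁆ ⊆ _
  ∪⊆ y∈ with x∈p∪q⁻ q ⁅ x ⁆ y∈
  ... | inj₁ y∈q = q⊆p y∈q
  ... | inj₂ y∈⁅x⁆ = ⁅x⁆⊆p x∈p y∈⁅x⁆

p∩[∁p∪⁅x⁆]≡⁅x⁆ : ∀ {n} {p : Subset n} {x} → x ∈ p → p ∩ (∁ p ∪ ⁅ x ⁆) ≡ ⁅ x ⁆
p∩[∁p∪⁅x⁆]≡⁅x⁆ {p = p} {x} x∈p =
  ⊆-antisym ⊆⁅x⁆ (⁅x⁆⊆p (x∈p∩q⁺ (x∈p , x∈p∪q⁺ (inj₂ (x∈⁅x⁆ x)))))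
  where
  ⊆⁅x⁆ : p ∩ (∁ p ∪ ⁅ x ⁆) ⊆ ⁅ x ⁆
  ⊆⁅x⁆ y∈ with x∈p∩q⁻ p _ y∈
  ... | y∈p , y∈∪ with x∈p∪q⁻ (∁ p) ⁅ x ⁆ y∈∪
  ...   | inj₁ y∈∁p = ⊥-elim (x∈∁p⇒x∉p y∈∁p y∈p)
  ...   | inj₂ y∈⁅x⁆ = y∈⁅x⁆

⊆∧⊄⇒⊇ : ∀ {n} {p q : Subset n} → p ⊆ q → ¬ p ⊂ q → q ⊆ p
⊆∧⊄⇒⊇ {p = p} p⊆q p⊄q {x} x∈q with x ∈? p
... | yes x∈p = x∈p
... | no  x∉p = ⊥-elim (p⊄q (p⊆q , x , x∈q , x∉p))

fort-lone-neighbour : ∀ {n} {G : Graph n} {F v y} → Fort G F → v ∉ F → y ∈ F → Adj G v y →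
                      (∀ {z} → Adj G v z → z ∈ F → z ≡ y) → False
fort-lone-neighbour {G = G} {F} {v} {y} (_ , fort) v∉F y∈F vy unique =
  fort v v∉F (trans (cong ∣_∣ F∩N≡⁅y⁆) (∣⁅x⁆∣≡1 y))
  where
  F∩N⊆⁅y⁆ : F ∩ N G v ⊆ ⁅ y ⁆
  F∩N⊆⁅y⁆ z∈ with x∈p∩q⁻ F (N G v) z∈
  ... | z∈F , z∈N = subst (_∈ ⁅ y ⁆) (sym (unique (∈-tabulate⁻ z∈N) z∈F)) (x∈⁅x⁆ y)
  F∩N≡⁅y⁆ : F ∩ N G v ≡ ⁅ y ⁆
  F∩N≡⁅y⁆ = ⊆-antisym F∩N⊆⁅y⁆ (⁅x⁆⊆p (x∈p∩q⁺ (y∈F , ∈-tabulate⁺ vy)))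

two-neighbours⇒Fort : ∀ {n} {G : Graph n} {F} → Nonempty F →
  (∀ {v} → v ∉ F → ∃₂ λ a b → a ≢ b × (a ∈ F × Adj G v a) × (b ∈ F × Adj G v b)) → Fort G F
two-neighbours⇒Fort nonempty two = nonempty , λ v v∉F ∣F∩N∣≡1 →
  let a , b , a≢b , (a∈F , va) , (b∈F , vb) = two v∉F
  in 1+n≰n (subst (2 ≤_) ∣F∩N∣≡1
       (x≢y⇒2≤∣p∣ (x∈p∩q⁺ (a∈F , ∈-tabulate⁺ va)) (x∈p∩q⁺ (b∈F , ∈-tabulate⁺ vb)) a≢b))

ZIr-⁅⁆ : ∀ {n} {G : Graph n} (x : Fin n) → ZIr G ⁅ x ⁆
ZIr-⁅⁆ x y y∈⁅x⁆ =
  ⊤ , ((x , ∈⊤) , λ v v∉⊤ → ⊥-elim (v∉⊤ ∈⊤)) ,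
  trans (∩-identityʳ ⁅ x ⁆) (cong ⁅_⁆ (sym (x∈⁅y⁆⇒x≡y x y∈⁅x⁆)))

ZIr-⊆-transversal : ∀ {n} {G : Graph n} {T A} → ZIr G T → A ⊆ T →
                    (∀ {F} → Fort G F → Nonempty (A ∩ F)) → T ⊆ A
ZIr-⊆-transversal {A = A} zir A⊆T meets {x} x∈T =
  let F , fort , T∩F≡⁅x⁆ = zir x x∈T
      a , a∈A∩F = meets fort
      a∈A , a∈F = x∈p∩q⁻ A F a∈A∩F
  in subst (_∈ A) (x∈⁅y⁆⇒x≡y x (subst (a ∈_) T∩F≡⁅x⁆ (x∈p∩q⁺ (A⊆T a∈A , a∈F)))) a∈A

two-outer-neighbours⇒ZIr : ∀ {n} {G : Graph n} {S} →
  (∀ {v} → v ∈ S → ∃₂ λ a b → a ≢ b × (a ∉ S × Adj G v a) × (b ∉ S × Adj G v b)) → ZIr G S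
two-outer-neighbours⇒ZIr {G = G} {S} two x x∈S = ∁ S ∪ ⁅ x ⁆ , fort , p∩[∁p∪⁅x⁆]≡⁅x⁆ x∈S
  where
  ∉S⇒∈F : ∀ {y} → y ∉ S → y ∈ ∁ S ∪ ⁅ x ⁆
  ∉S⇒∈F y∉S = x∈p∪q⁺ (inj₁ (x∉p⇒x∈∁p y∉S))
  fort : Fort G (∁ S ∪ ⁅ x ⁆)
  fort = two-neighbours⇒Fort {G = G} (x , x∈p∪q⁺ (inj₂ (x∈⁅x⁆ x))) λ {v} v∉F →
    let a , b , a≢b , (a∉S , va) , (b∉S , vb) = two (decidable-stable (v ∈? S) (v∉F ∘ ∉S⇒∈F))
    in a , b , a≢b , (∉S⇒∈F a∉S , va) , (∉S⇒∈F b∉S , vb)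

MaximalZIr⇒Nonempty : ∀ {n} {G : Graph n} {S} → MaximalZIr G S → Fin n → Nonempty S
MaximalZIr⇒Nonempty {G = G} {S} (_ , maximal) x with nonempty? S
... | yes nonempty = nonempty
... | no  empty    = ⊥-elim (maximal ⁅ x ⁆ S⊂⁅x⁆ (ZIr-⁅⁆ {G = G} x))
  where
  S⊂⁅x⁆ : S ⊂ ⁅ x ⁆
  S⊂⁅x⁆ = (λ y∈S → ⊥-elim (empty (_ , y∈S))) , x , x∈⁅x⁆ x , λ x∈S → empty (x , x∈S)

ZFS⇒Nonempty : ∀ {n} {G : Graph n} {B} → ZFS G B → Fin n → Nonempty B
ZFS⇒Nonempty ε                       x = x , ∈⊤
ZFS⇒Nonempty ((u , _ , u∈B , _) ◅ _) _ = u , u∈B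

MinimalZFS⇒∣B∣≤∣A∣ : ∀ {n} {G : Graph n} {A B} → MinimalZFS G B → A ⊆ B → ZFS G A → ∣ B ∣ ≤ ∣ A ∣
MinimalZFS⇒∣B∣≤∣A∣ (_ , minimal) A⊆B zfsA =
  p⊆q⇒∣p∣≤∣q∣ (⊆∧⊄⇒⊇ A⊆B λ A⊂B → minimal _ A⊂B zfsA)

≥-induction₂ : ∀ {ℓ} (Q : ℕ → Set ℓ) → (∀ {k} → Q k → Q (suc k) → Q (suc (suc k))) →
               ∀ {k} → Q k → Q (suc k) → ∀ {j} → k ≤ j → Q j
≥-induction₂ Q step {k} q₀ q₁ {j} k≤j = subst Q (m∸n+n≡m k≤j) (proj₁ (from-k (j ∸ k)))
  where
  from-k : ∀ i → Q (i + k) × Q (suc (i + k))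
  from-k zero    = q₀ , q₁
  from-k (suc i) = let qᵢ , qᵢ₊₁ = from-k i in qᵢ₊₁ , step qᵢ qᵢ₊₁

_⋖_ : ∀ {n} → Fin n → Fin n → Set
u ⋖ v = suc (toℕ u) ≡ toℕ v

Endpoint : ∀ {n} → Fin n → Set
Endpoint {n} z = toℕ z ≡ 0 ⊎ suc (toℕ z) ≡ n

vertex : ∀ {n k} → k < n → ∃ λ (v : Fin n) → toℕ v ≡ k
vertex k<n = fromℕ< k<n , toℕ-fromℕ< k<n

last-vertex : ∀ {n} → Fin n → ∃ λ (ℓ : Fin n) → suc (toℕ ℓ) ≡ n
last-vertex {suc m} _ = fromℕ m , cong suc (toℕ-fromℕ m)

⋖-functional : ∀ {n} {u v w : Fin n} → u ⋖ v → u ⋖ w → v ≡ w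
⋖-functional u⋖v u⋖w = toℕ-injective (trans (sym u⋖v) u⋖w)

⋖-injective : ∀ {n} {u v w : Fin n} → u ⋖ w → v ⋖ w → u ≡ v
⋖-injective u⋖w v⋖w = toℕ-injective (suc-injective (trans u⋖w (sym v⋖w)))

⋖-asym : ∀ {n} {u v : Fin n} → u ⋖ v → ¬ v ⋖ u
⋖-asym u⋖v v⋖u = <-asym (≤-reflexive u⋖v) (≤-reflexive v⋖u)

first-or-predecessor : ∀ {n} (u : Fin n) → toℕ u ≡ 0 ⊎ ∃ λ v → v ⋖ u
first-or-predecessor zero    = inj₁ refl
first-or-predecessor (suc u) = inj₂ (inject₁ u , cong suc (toℕ-inject₁ u))

last-or-successor : ∀ {n} (u : Fin n) → suc (toℕ u) ≡ n ⊎ ∃ λ v → u ⋖ v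
last-or-successor {suc zero}    zero    = inj₁ refl
last-or-successor {suc (suc n)} zero    = inj₂ (suc zero , refl)
last-or-successor               (suc u) with last-or-successor u
... | inj₁ u+1≡n       = inj₁ (cong suc u+1≡n)
... | inj₂ (v , u⋖v)   = inj₂ (suc v , cong suc u⋖v)

Adj-P⁻ : ∀ {n} {u v : Fin n} → Adj (P n) u v → u ⋖ v ⊎ v ⋖ u
Adj-P⁻ {u = u} {v} uv with to T-∨ (from T-≡ uv)
... | inj₁ u+1≡v = inj₁ (trans (+-comm 1 (toℕ u)) (≡ᵇ⇒≡ _ _ u+1≡v))
... | inj₂ v+1≡u = inj₂ (trans (+-comm 1 (toℕ v)) (≡ᵇ⇒≡ _ _ v+1≡u))

⋖⇒Adj : ∀ {n} {u v : Fin n} → u ⋖ v → Adj (P n) u v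
⋖⇒Adj {u = u} u⋖v = to T-≡ (from T-∨ (inj₁ (≡⇒≡ᵇ _ _ (trans (+-comm (toℕ u) 1) u⋖v))))

⋗⇒Adj : ∀ {n} {u v : Fin n} → v ⋖ u → Adj (P n) u v
⋗⇒Adj {v = v} v⋖u = to T-≡ (from T-∨ (inj₂ (≡⇒≡ᵇ _ _ (trans (+-comm (toℕ v) 1) v⋖u))))

module _ {n} {F : Subset n} (fort : Fort (P n) F) where

  private
    ∉-by-index : ∀ {y z} → z ∉ F → toℕ y ≡ toℕ z → y ∉ F
    ∉-by-index z∉F y≡z = subst (_∉ F) (sym (toℕ-injective y≡z)) z∉F

    lone-successor : ∀ {c z} → c ∉ F → c ⋖ z → z ∈ F → (∀ {y} → y ⋖ c → y ∉ F) → False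
    lone-successor c∉F c⋖z z∈F pred∉F =
      fort-lone-neighbour {G = P n} fort c∉F z∈F (⋖⇒Adj c⋖z) λ cy y∈F →
      [ (λ c⋖y → ⋖-functional c⋖y c⋖z) , (λ y⋖c → ⊥-elim (pred∉F y⋖c y∈F)) ] (Adj-P⁻ cy)

    lone-predecessor : ∀ {c z} → c ∉ F → z ⋖ c → z ∈ F → (∀ {y} → c ⋖ y → y ∉ F) → False
    lone-predecessor c∉F z⋖c z∈F succ∉F =
      fort-lone-neighbour {G = P n} fort c∉F z∈F (⋗⇒Adj z⋖c) λ cy y∈F →
      [ (λ c⋖y → ⊥-elim (succ∉F c⋖y y∈F)) , (λ y⋖c → ⋖-injective y⋖c z⋖c) ] (Adj-P⁻ cy)

    -- Vacant↑ k says that vertex k − 1 lies outside F, Vacant↓ k that vertex n − k does;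
    -- both hold vacuously for k = 0, so a propagation can start at either end of the path.
    Vacant↑ Vacant↓ : ℕ → Set
    Vacant↑ k = ∀ {z} → suc (toℕ z) ≡ k → z ∉ F
    Vacant↓ k = ∀ {z} → k + toℕ z ≡ n → z ∉ F

    vacant↑-step : ∀ {k} → Vacant↑ k → Vacant↑ (suc k) → Vacant↑ (suc (suc k))
    vacant↑-step {k} vac₀ vac₁ {z} z≡k+1 z∈F =
      let c , c≡k = vertex {k = k} (≤-trans (n≤1+n (suc k)) (subst (_≤ n) z≡k+1 (toℕ<n z)))
      in lone-successor (vac₁ (cong suc c≡k)) (trans (cong suc c≡k) (sym (suc-injective z≡k+1))) z∈F
                        (λ y⋖c → vac₀ (trans y⋖c c≡k))

    vacant↓-step : ∀ {k} → Vacant↓ k → Vacant↓ (suc k) → Vacant↓ (suc (suc k))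
    vacant↓-step {k} vac₀ vac₁ {z} k+z+2≡n z∈F =
      let c , c≡z+1 = vertex (subst (suc (suc (toℕ z)) ≤_) k+z+2≡n (s≤s (s≤s (m≤n+m (toℕ z) k))))
          k+c+1≡n = begin
            suc k + toℕ c          ≡⟨ cong (λ m → suc (k + m)) c≡z+1 ⟩
            suc (k + suc (toℕ z))  ≡⟨ cong suc (+-suc k (toℕ z)) ⟩
            suc (suc (k + toℕ z))  ≡⟨ k+z+2≡n ⟩
            n                      ∎
          k+y≡n = λ {y} (c⋖y : c ⋖ y) → begin
            k + toℕ y                    ≡⟨ cong (k +_) (trans (sym c⋖y) (cong suc c≡z+1)) ⟩
            k + suc (suc (toℕ z))        ≡⟨ +-suc k (suc (toℕ z)) ⟩
            suc (k + suc (toℕ z))        ≡⟨ cong suc (+-suc k (toℕ z)) ⟩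
            suc (suc (k + toℕ z))        ≡⟨ k+z+2≡n ⟩
            n                            ∎
      in lone-predecessor (vac₁ k+c+1≡n) (sym c≡z+1) z∈F (λ c⋖y → vac₀ (k+y≡n c⋖y))

  fort-first : ∀ {z} → toℕ z ≡ 0 → z ∈ F
  fort-first {z} z≡0 = decidable-stable (z ∈? F) λ z∉F →
    let v , v∈F = proj₁ fort
        vac₁ : Vacant↑ 1
        vac₁ y+1≡1 = ∉-by-index z∉F (trans (suc-injective y+1≡1) (sym z≡0))
    in ≥-induction₂ Vacant↑ vacant↑-step (λ ()) vac₁ {suc (toℕ v)} z≤n refl v∈F

  fort-last : ∀ {z} → suc (toℕ z) ≡ n → z ∈ F
  fort-last {z} z+1≡n = decidable-stable (z ∈? F) λ z∉F →
    let v , v∈F = proj₁ fort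
        vac₀ : Vacant↓ 0
        vac₀ {y} y≡n = ⊥-elim (<-irrefl y≡n (toℕ<n y))
        vac₁ : Vacant↓ 1
        vac₁ y+1≡n = ∉-by-index z∉F (suc-injective (trans y+1≡n (sym z+1≡n)))
    in ≥-induction₂ Vacant↓ vacant↓-step vac₀ vac₁ z≤n (m∸n+n≡m (<⇒≤ (toℕ<n v))) v∈F

  fort-endpoint : ∀ {z} → Endpoint z → z ∈ F
  fort-endpoint = [ fort-first , fort-last ]

  fort-edge : ∀ {a b} → a ⋖ b → a ∈ F ⊎ b ∈ F
  fort-edge {a} {b} a⋖b with a ∈? F | b ∈? F
  ... | yes a∈F | _       = inj₁ a∈F
  ... | no _    | yes b∈F = inj₂ b∈F
  ... | no a∉F  | no b∉F  =
    let ℓ , ℓ+1≡n = last-vertex a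
        vac₀ : Vacant↑ (suc (toℕ a))
        vac₀ y+1≡a+1 = ∉-by-index a∉F (suc-injective y+1≡a+1)
        vac₁ : Vacant↑ (suc (suc (toℕ a)))
        vac₁ y+1≡a+2 = ∉-by-index b∉F (trans (suc-injective y+1≡a+2) a⋖b)
        a≤ℓ = ≤-pred (subst (suc (toℕ a) ≤_) (sym ℓ+1≡n) (toℕ<n a))
    in ⊥-elim (≥-induction₂ Vacant↑ vacant↑-step vac₀ vac₁ (s≤s a≤ℓ) refl (fort-last ℓ+1≡n))

ZIr-endpoint : ∀ {n} {T : Subset n} {z} → ZIr (P n) T → Endpoint z → z ∈ T → T ⊆ ⁅ z ⁆
ZIr-endpoint {n} {z = z} zir end z∈T =
  ZIr-⊆-transversal {G = P n} zir (⁅x⁆⊆p z∈T) λ fort → z , x∈p∩q⁺ (x∈⁅x⁆ z , fort-endpoint fort end)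

ZIr-edge : ∀ {n} {T : Subset n} {a b} → ZIr (P n) T → a ⋖ b → a ∈ T → b ∈ T → T ⊆ ⁅ a ⁆ ∪ ⁅ b ⁆
ZIr-edge {n} {a = a} {b} zir a⋖b a∈T b∈T =
  ZIr-⊆-transversal {G = P n} zir (⁅x⁆∪⁅y⁆⊆p a∈T b∈T) λ fort →
  [ (λ a∈F → a , x∈p∩q⁺ (x∈p∪q⁺ (inj₁ (x∈⁅x⁆ a)) , a∈F))
  , (λ b∈F → b , x∈p∩q⁺ (x∈p∪q⁺ (inj₂ (x∈⁅x⁆ b)) , b∈F)) ] (fort-edge fort a⋖b)

ZIr-endpoint-free : ∀ {n} {T : Subset n} {z} → ZIr (P n) T → 2 ≤ ∣ T ∣ → z ∈ T → ¬ Endpoint z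
ZIr-endpoint-free {z = z} zir 2≤∣T∣ z∈T end =
  <⇒≱ 2≤∣T∣ (≤-trans (p⊆q⇒∣p∣≤∣q∣ (ZIr-endpoint zir end z∈T)) (≤-reflexive (∣⁅x⁆∣≡1 z)))

ZIr-edge-free : ∀ {n} {T : Subset n} {a b} → ZIr (P n) T → 3 ≤ ∣ T ∣ → a ⋖ b → a ∈ T → b ∉ T
ZIr-edge-free {a = a} {b} zir 3≤∣T∣ a⋖b a∈T b∈T =
  <⇒≱ 3≤∣T∣ (≤-trans (p⊆q⇒∣p∣≤∣q∣ (ZIr-edge zir a⋖b a∈T b∈T)) (∣⁅x⁆∪⁅y⁆∣≤2 a b))

Spaced : ∀ {n} → Subset n → Set
Spaced p = ∀ {i} → i ∈ p → ∃ λ j → i ⋖ j × j ∉ p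

ZIr-spaced : ∀ {n} {T : Subset n} → ZIr (P n) T → 3 ≤ ∣ T ∣ → Spaced T
ZIr-spaced zir 3≤∣T∣ {i} i∈T with last-or-successor i
... | inj₁ i+1≡n     = ⊥-elim (ZIr-endpoint-free zir (≤-trans (n≤1+n 2) 3≤∣T∣) i∈T (inj₂ i+1≡n))
... | inj₂ (j , i⋖j) = j , i⋖j , ZIr-edge-free zir 3≤∣T∣ i⋖j i∈T

spaced-tail : ∀ {n s} {p : Subset n} → Spaced (s ∷ p) → Spaced p
spaced-tail spaced i∈p with spaced (there i∈p)
... | suc j , i⋖j , j∉ = j , suc-injective i⋖j , j∉ ∘ there

Spaced⇒∣p∣*2≤n : ∀ {n} (p : Subset n) → Spaced p → ∣ p ∣ * 2 ≤ n
Spaced⇒∣p∣*2≤n []                     _      = z≤n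
Spaced⇒∣p∣*2≤n (outside ∷ p)          spaced = m≤n⇒m≤1+n (Spaced⇒∣p∣*2≤n p (spaced-tail spaced))
Spaced⇒∣p∣*2≤n (inside ∷ outside ∷ p) spaced =
  s≤s (s≤s (Spaced⇒∣p∣*2≤n p (spaced-tail (spaced-tail spaced))))
Spaced⇒∣p∣*2≤n (inside ∷ inside ∷ p)  spaced with spaced here
... | suc zero , _ , 1∉ = ⊥-elim (1∉ (there here))
Spaced⇒∣p∣*2≤n (inside ∷ [])          spaced with spaced here
... | zero , () , _

ZIr-P⇒∣S∣≤m/2 : ∀ {m} {S : Subset (suc m)} → ZIr (P (suc m)) S → 4 ≤ m → ∣ S ∣ ≤ m / 2
ZIr-P⇒∣S∣≤m/2 {m} {S} zir 4≤m with ∣ S ∣ ≤? 2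
... | yes ∣S∣≤2 = ≤-trans ∣S∣≤2 (/-monoˡ-≤ 2 4≤m)
... | no  ∣S∣≰2 =
  subst (_≤ m / 2) (m*n/n≡m ∣ S ∣ 2) (/-monoˡ-≤ 2 (interior-card S 0∉S (ZIr-spaced zir 3≤∣S∣)))
  where
  3≤∣S∣ = ≰⇒> ∣S∣≰2
  0∉S : zero ∉ S
  0∉S 0∈S = ZIr-endpoint-free zir (≤-trans (n≤1+n 2) 3≤∣S∣) 0∈S (inj₁ refl)
  interior-card : ∀ (p : Subset (suc m)) → zero ∉ p → Spaced p → ∣ p ∣ * 2 ≤ m
  interior-card (outside ∷ p) _   spaced = Spaced⇒∣p∣*2≤n p (spaced-tail spaced)
  interior-card (inside ∷ p)  0∉p _      = ⊥-elim (0∉p here)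

-- Opaque, so that the bounds a and b can be inferred from a goal x ∈ interval a b.
opaque
  interval : ∀ {n} → ℕ → ℕ → Subset n
  interval a b = tabulate λ i → (a ≤ᵇ toℕ i) ∧ (toℕ i ≤ᵇ b)

  ∈-interval⁺ : ∀ {n a b} {x : Fin n} → a ≤ toℕ x → toℕ x ≤ b → x ∈ interval a b
  ∈-interval⁺ a≤x x≤b = ∈-tabulate⁺ (to T-≡ (from T-∧ (≤⇒≤ᵇ a≤x , ≤⇒≤ᵇ x≤b)))

  ∈-interval⁻ : ∀ {n a b} {x : Fin n} → x ∈ interval a b → a ≤ toℕ x × toℕ x ≤ b
  ∈-interval⁻ {a = a} {b} {x} x∈ =
    let a≤ᵇx , x≤ᵇb = to T-∧ (from T-≡ (∈-tabulate⁻ x∈))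
    in ≤ᵇ⇒≤ a (toℕ x) a≤ᵇx , ≤ᵇ⇒≤ (toℕ x) b x≤ᵇb

interval-⊤ : ∀ {n} → interval 0 (pred n) ≡ ⊤ {n}
interval-⊤ = ⊆-antisym (λ _ → ∈⊤) (λ {x} _ → ∈-interval⁺ z≤n (<⇒≤pred (toℕ<n x)))

interval-⁅⁆ : ∀ {n} (x : Fin n) → interval (toℕ x) (toℕ x) ≡ ⁅ x ⁆
interval-⁅⁆ x = ⊆-antisym ⊆⁅x⁆ (⁅x⁆⊆p (∈-interval⁺ ≤-refl ≤-refl))
  where
  ⊆⁅x⁆ : interval (toℕ x) (toℕ x) ⊆ ⁅ x ⁆
  ⊆⁅x⁆ y∈ = let x≤y , y≤x = ∈-interval⁻ y∈
            in subst (_∈ ⁅ x ⁆) (sym (toℕ-injective (≤-antisym y≤x x≤y))) (x∈⁅x⁆ x)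

interval-extendʳ : ∀ {n a c} {w : Fin n} → toℕ w ≡ suc c → a ≤ suc c →
                   interval a (suc c) ≡ interval a c ∪ ⁅ w ⁆
interval-extendʳ {a = a} {c} {w} w≡c+1 a≤c+1 = p≡q∪⁅x⁆ split
  (λ y∈ → let a≤y , y≤c = ∈-interval⁻ y∈ in ∈-interval⁺ a≤y (m≤n⇒m≤1+n y≤c))
  (∈-interval⁺ (subst (a ≤_) (sym w≡c+1) a≤c+1) (≤-reflexive w≡c+1))
  where
  split : ∀ {y} → y ∈ interval a (suc c) → y ∈ interval a c ⊎ y ≡ w
  split y∈ with ∈-interval⁻ y∈
  ... | a≤y , y≤c+1 with m≤n⇒m<n∨m≡n y≤c+1
  ...   | inj₁ y<c+1 = inj₁ (∈-interval⁺ a≤y (≤-pred y<c+1))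
  ...   | inj₂ y≡c+1 = inj₂ (toℕ-injective (trans y≡c+1 (sym w≡c+1)))

interval-extendˡ : ∀ {n a c} {w : Fin n} → toℕ w ≡ a → a ≤ c →
                   interval a c ≡ interval (suc a) c ∪ ⁅ w ⁆
interval-extendˡ {a = a} {c} {w} w≡a a≤c = p≡q∪⁅x⁆ split
  (λ y∈ → let a<y , y≤c = ∈-interval⁻ y∈ in ∈-interval⁺ (<⇒≤ a<y) y≤c)
  (∈-interval⁺ (≤-reflexive (sym w≡a)) (subst (_≤ c) (sym w≡a) a≤c))
  where
  split : ∀ {y} → y ∈ interval a c → y ∈ interval (suc a) c ⊎ y ≡ w
  split y∈ with ∈-interval⁻ y∈
  ... | a≤y , y≤c with m≤n⇒m<n∨m≡n a≤y
  ...   | inj₁ a<y = inj₁ (∈-interval⁺ a<y y≤c)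
  ...   | inj₂ a≡y = inj₂ (toℕ-injective (trans (sym a≡y) (sym w≡a)))

force-up : ∀ {n} {B C : Subset n} {u w} → u ∈ B → u ⋖ w → w ∉ B →
           (∀ {v} → v ⋖ u → v ∈ B) → C ≡ B ∪ ⁅ w ⁆ → Force (P n) B C
force-up {u = u} {w} u∈B u⋖w w∉B pred∈B C≡ = u , w , u∈B , w∉B , ⋖⇒Adj u⋖w , others , C≡
  where
  others = λ v uv v≢w → [ (λ u⋖v → ⊥-elim (v≢w (⋖-functional u⋖v u⋖w))) , pred∈B ] (Adj-P⁻ uv)

force-down : ∀ {n} {B C : Subset n} {u w} → u ∈ B → w ⋖ u → w ∉ B →
             (∀ {v} → u ⋖ v → v ∈ B) → C ≡ B ∪ ⁅ w ⁆ → Force (P n) B C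
force-down {u = u} {w} u∈B w⋖u w∉B succ∈B C≡ = u , w , u∈B , w∉B , ⋗⇒Adj w⋖u , others , C≡
  where
  others = λ v uv v≢w → [ succ∈B , (λ v⋖u → ⊥-elim (v≢w (⋖-injective v⋖u w⋖u))) ] (Adj-P⁻ uv)

force-rightwards : ∀ {n a c} → a ≤ pred c → suc c < n →
                   Force (P n) (interval a c) (interval a (suc c))
force-rightwards {a = a} {c} a≤c-1 c+1<n =
  let u , u≡c   = vertex (≤-trans (n≤1+n (suc c)) c+1<n)
      w , w≡c+1 = vertex c+1<n
      a≤c       = ≤pred⇒≤ a≤c-1
  in force-up (∈-interval⁺ (subst (a ≤_) (sym u≡c) a≤c) (≤-reflexive u≡c))
              (trans (cong suc u≡c) (sym w≡c+1))
              (λ w∈ → 1+n≰n (subst (_≤ c) w≡c+1 (proj₂ (∈-interval⁻ w∈))))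
              (λ v⋖u → ∈-interval⁺ (subst (a ≤_) (cong pred (sym (trans v⋖u u≡c))) a≤c-1)
                                   (≤-trans (n≤1+n _) (≤-reflexive (trans v⋖u u≡c))))
              (interval-extendʳ w≡c+1 (m≤n⇒m≤1+n a≤c))

force-leftwards : ∀ {n a} → suc a < n →
                  Force (P n) (interval (suc a) (pred n)) (interval a (pred n))
force-leftwards {a = a} a+1<n =
  let u , u≡a+1 = vertex a+1<n
      w , w≡a   = vertex (≤-trans (n≤1+n (suc a)) a+1<n)
  in force-down (∈-interval⁺ (≤-reflexive (sym u≡a+1)) (<⇒≤pred (toℕ<n u)))
                (trans (cong suc w≡a) (sym u≡a+1))
                (λ w∈ → 1+n≰n (subst (suc a ≤_) w≡a (proj₁ (∈-interval⁻ w∈))))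
                (λ {v} u⋖v →
                   let a+2≡v = trans (cong suc (sym u≡a+1)) u⋖v
                   in ∈-interval⁺ (≤-trans (n≤1+n _) (≤-reflexive a+2≡v)) (<⇒≤pred (toℕ<n v)))
                (interval-extendˡ w≡a (≤-trans (n≤1+n a) (<⇒≤pred a+1<n)))

sweep-right : ∀ {n a b} d → a ≤ pred b → d + b < n →
              Star (Force (P n)) (interval a b) (interval a (d + b))
sweep-right zero    _      _        = ε
sweep-right {b = b} (suc d) a≤b-1 d+b+1<n =
  sweep-right d a≤b-1 (≤-trans (n≤1+n _) d+b+1<n)
  ◅◅ force-rightwards (≤-trans a≤b-1 (pred-mono-≤ (m≤n+m b d))) d+b+1<n ◅ ε

sweep-left : ∀ {n} a → a < n → Star (Force (P n)) (interval a (pred n)) ⊤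
sweep-left {n} zero    _     = subst (Star (Force (P n)) (interval 0 (pred n))) interval-⊤ ε
sweep-left     (suc a) a+1<n = force-leftwards a+1<n ◅ sweep-left a (≤-trans (n≤1+n _) a+1<n)

interval-ZFS : ∀ {n a b} → a ≤ pred b → b < n → ZFS (P n) (interval a b)
interval-ZFS {suc m} {a} {b} a≤b-1 (s≤s b≤m) =
  subst (Star (Force (P (suc m))) (interval a b) ∘ interval a) d+b≡m
        (sweep-right (m ∸ b) a≤b-1 (s≤s (≤-reflexive d+b≡m)))
  ◅◅ sweep-left a (s≤s (≤-trans (≤pred⇒≤ a≤b-1) b≤m))
  where
  d+b≡m = m∸n+n≡m b≤m

endpoint-ZFS : ∀ {n} {z : Fin n} → Endpoint z → ZFS (P n) ⁅ z ⁆
endpoint-ZFS {n} {z} (inj₁ z≡0) =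
  subst (ZFS (P n)) (interval-⁅⁆ z)
        (interval-ZFS (subst (λ k → k ≤ pred k) (sym z≡0) z≤n) (toℕ<n z))
endpoint-ZFS {n} {z} (inj₂ z+1≡n) =
  subst (ZFS (P n)) (trans (cong (interval (toℕ z) ∘ pred) (sym z+1≡n)) (interval-⁅⁆ z))
        (sweep-left (toℕ z) (toℕ<n z))

edge-ZFS : ∀ {n} {a b : Fin n} → a ⋖ b → ZFS (P n) (⁅ a ⁆ ∪ ⁅ b ⁆)
edge-ZFS {n} {a} {b} a⋖b =
  subst (ZFS (P n)) interval≡⁅a⁆∪⁅b⁆ (interval-ZFS (≤-reflexive (cong pred a⋖b)) (toℕ<n b))
  where
  interval≡⁅a⁆∪⁅b⁆ : interval (toℕ a) (toℕ b) ≡ ⁅ a ⁆ ∪ ⁅ b ⁆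
  interval≡⁅a⁆∪⁅b⁆ = begin
    interval (toℕ a) (toℕ b)          ≡⟨ cong (interval (toℕ a)) (sym a⋖b) ⟩
    interval (toℕ a) (suc (toℕ a))    ≡⟨ interval-extendʳ (sym a⋖b) (n≤1+n _) ⟩
    interval (toℕ a) (toℕ a) ∪ ⁅ b ⁆  ≡⟨ cong (_∪ ⁅ b ⁆) (interval-⁅⁆ a) ⟩
    ⁅ a ⁆ ∪ ⁅ b ⁆                     ∎

ZFS⇒endpoint⊎edge : ∀ {m} {B : Subset (suc m)} → ZFS (P (suc m)) B →
                    (∃ λ z → Endpoint z × z ∈ B) ⊎ (∃₂ λ a b → a ⋖ b × a ∈ B × b ∈ B)
ZFS⇒endpoint⊎edge ε = inj₁ (zero , inj₁ refl , ∈⊤)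
ZFS⇒endpoint⊎edge ((u , w , u∈B , _ , uw , others , _) ◅ _)
  with Adj-P⁻ uw | first-or-predecessor u | last-or-successor u
... | _          | inj₁ u≡0       | _              = inj₁ (u , inj₁ u≡0 , u∈B)
... | _          | _              | inj₁ u+1≡n     = inj₁ (u , inj₂ u+1≡n , u∈B)
... | inj₁ u⋖w   | inj₂ (v , v⋖u) | _              =
  inj₂ (v , u , v⋖u , others v (⋗⇒Adj v⋖u) (λ v≡w → ⋖-asym u⋖w (subst (_⋖ u) v≡w v⋖u)) , u∈B)
... | inj₂ w⋖u   | _              | inj₂ (v , u⋖v) =
  inj₂ (u , v , u⋖v , u∈B , others v (⋖⇒Adj u⋖v) (λ v≡w → ⋖-asym w⋖u (subst (u ⋖_) v≡w u⋖v)))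

MinimalZFS-P⇒∣B∣≤2 : ∀ {m} {B : Subset (suc m)} → MinimalZFS (P (suc m)) B → ∣ B ∣ ≤ 2
MinimalZFS-P⇒∣B∣≤2 {m} minimal with ZFS⇒endpoint⊎edge (proj₁ minimal)
... | inj₁ (z , end , z∈B) =
  m≤n⇒m≤1+n (subst (_ ≤_) (∣⁅x⁆∣≡1 z)
    (MinimalZFS⇒∣B∣≤∣A∣ {G = P (suc m)} minimal (⁅x⁆⊆p z∈B) (endpoint-ZFS end)))
... | inj₂ (a , b , a⋖b , a∈B , b∈B) =
  ≤-trans (MinimalZFS⇒∣B∣≤∣A∣ {G = P (suc m)} minimal (⁅x⁆∪⁅y⁆⊆p a∈B b∈B) (edge-ZFS a⋖b))
          (∣⁅x⁆∪⁅y⁆∣≤2 a b)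

⁅1⁆∪⁅2⁆-MinimalZFS : ∀ {m} → MinimalZFS (P (4 + m)) (⁅ suc zero ⁆ ∪ ⁅ suc (suc zero) ⁆)
⁅1⁆∪⁅2⁆-MinimalZFS {m} = edge-ZFS {a = v₁} {v₂} refl , minimal
  where
  v₁ v₂ : Fin (4 + m)
  v₁ = suc zero
  v₂ = suc (suc zero)
  W = ⁅ v₁ ⁆ ∪ ⁅ v₂ ⁆
  not-endpoint : ∀ {z} → z ∈ W → ¬ Endpoint z
  not-endpoint z∈W end with ∈⁅x⁆∪⁅y⁆⁻ v₁ v₂ z∈W | end
  ... | inj₁ refl | inj₁ ()
  ... | inj₁ refl | inj₂ ()
  ... | inj₂ refl | inj₁ ()
  ... | inj₂ refl | inj₂ ()
  edge-is-W : ∀ {a b} → a ∈ W → b ∈ W → a ⋖ b → W ⊆ ⁅ a ⁆ ∪ ⁅ b ⁆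
  edge-is-W a∈W b∈W a⋖b with ∈⁅x⁆∪⁅y⁆⁻ v₁ v₂ a∈W | ∈⁅x⁆∪⁅y⁆⁻ v₁ v₂ b∈W | a⋖b
  ... | inj₁ refl | inj₂ refl | _  = λ x∈W → x∈W
  ... | inj₁ refl | inj₁ refl | ()
  ... | inj₂ refl | inj₁ refl | ()
  ... | inj₂ refl | inj₂ refl | ()
  minimal : ∀ B → B ⊂ W → ¬ ZFS (P (4 + m)) B
  minimal B (B⊆W , x , x∈W , x∉B) zfs with ZFS⇒endpoint⊎edge zfs
  ... | inj₁ (z , end , z∈B)          = not-endpoint (B⊆W z∈B) end
  ... | inj₂ (a , b , a⋖b , a∈B , b∈B) =
    x∉B (⁅x⁆∪⁅y⁆⊆p a∈B b∈B (edge-is-W (B⊆W a∈B) (B⊆W b∈B) a⋖b x∈W))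

oddInner : ∀ n → Subset n
oddInner 0                   = []
oddInner 1                   = outside ∷ []
oddInner 2                   = outside ∷ outside ∷ []
oddInner (suc (suc (suc n))) = outside ∷ inside ∷ oddInner (suc n)

∣oddInner∣ : ∀ n → ∣ oddInner n ∣ ≡ (n ∸ 1) / 2
∣oddInner∣ 0                   = refl
∣oddInner∣ 1                   = refl
∣oddInner∣ 2                   = refl
∣oddInner∣ (suc (suc (suc n))) =
  trans (cong suc (∣oddInner∣ (suc n))) (sym (m/n≡1+[m∸n]/n {2 + n} {2} (s≤s (s≤s z≤n))))

0∉oddInner : ∀ {n} → zero ∉ oddInner (suc n)
0∉oddInner {0}           ()
0∉oddInner {1}           ()
0∉oddInner {suc (suc n)} ()

oddInner-isolated : ∀ {n} {i : Fin n} → i ∈ oddInner n →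
                    ∃₂ λ u w → u ⋖ i × i ⋖ w × u ∉ oddInner n × w ∉ oddInner n
oddInner-isolated {suc (suc (suc n))} (there here) =
  zero , suc (suc zero) , refl , refl , (λ ()) , λ { (there (there 0∈)) → 0∉oddInner 0∈ }
oddInner-isolated {suc (suc (suc n))} (there (there i∈)) =
  let u , w , u⋖i , i⋖w , u∉ , w∉ = oddInner-isolated {suc n} i∈
  in suc (suc u) , suc (suc w) , cong (2 +_) u⋖i , cong (2 +_) i⋖w ,
     (λ { (there (there u∈)) → u∉ u∈ }) , λ { (there (there w∈)) → w∉ w∈ }
oddInner-isolated {suc n} {zero} 0∈ = ⊥-elim (0∉oddInner 0∈)
oddInner-isolated {2} (there (there ()))

oddInner-dominating : ∀ {n} {i : Fin n} → i ∉ oddInner n → ¬ Endpoint i →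
                      ∃ λ u → u ⋖ i × u ∈ oddInner n
oddInner-dominating {i = zero} _ interior = ⊥-elim (interior (inj₁ refl))
oddInner-dominating {2} {suc zero} _ interior = ⊥-elim (interior (inj₂ refl))
oddInner-dominating {suc (suc (suc n))} {suc zero} i∉ _ = ⊥-elim (i∉ (there here))
oddInner-dominating {suc (suc (suc n))} {suc (suc zero)} _ _ = suc zero , refl , there here
oddInner-dominating {suc (suc (suc n))} {suc (suc (suc i))} i∉ interior =
  let u , u⋖i , u∈ = oddInner-dominating {suc n} (λ i∈ → i∉ (there (there i∈))) λ where
        (inj₁ ())
        (inj₂ i+1≡n) → interior (inj₂ (cong (2 +_) i+1≡n))
  in suc (suc u) , cong (2 +_) u⋖i , there (there u∈)

ZIr-oddInner : ∀ {n} → ZIr (P n) (oddInner n)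
ZIr-oddInner {n} = two-outer-neighbours⇒ZIr {G = P n} λ i∈ →
  let u , w , u⋖i , i⋖w , u∉ , w∉ = oddInner-isolated {n} i∈
  in u , w , (λ u≡w → ⋖-asym u⋖i (subst (_ ⋖_) (sym u≡w) i⋖w)) , (u∉ , ⋗⇒Adj u⋖i) , (w∉ , ⋖⇒Adj i⋖w)

oddInner-maximal : ∀ {n} → 5 ≤ n → ∀ T → oddInner n ⊂ T → ¬ ZIr (P n) T
oddInner-maximal {n} 5≤n T S⊂T@(S⊆T , y , y∈T , y∉S) zir =
  let 2≤∣S∣ = subst (2 ≤_) (sym (∣oddInner∣ n)) (/-monoˡ-≤ 2 (∸-monoˡ-≤ 1 5≤n))
      3≤∣T∣ = ≤-trans (s≤s 2≤∣S∣) (p⊂q⇒∣p∣<∣q∣ S⊂T)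
      interior = ZIr-endpoint-free zir (≤-trans (n≤1+n 2) 3≤∣T∣) y∈T
      u , u⋖y , u∈S = oddInner-dominating {n} y∉S interior
  in ZIr-edge-free zir 3≤∣T∣ u⋖y (S⊆T u∈S) y∈T

zir-P≡1 : ∀ m → zir≡ (P (suc m)) 1
zir-P≡1 m =
  (⁅ zero ⁆ , (ZIr-⁅⁆ {G = P (suc m)} zero , ⁅0⁆-maximal) , ∣⁅x⁆∣≡1 {suc m} zero) ,
  λ S maximal → x∈p⇒1≤∣p∣ (proj₂ (MaximalZIr⇒Nonempty {G = P (suc m)} maximal zero))
  where
  ⁅0⁆-maximal : ∀ T → ⁅ zero ⁆ ⊂ T → ¬ ZIr (P (suc m)) T
  ⁅0⁆-maximal T (⁅0⁆⊆T , y , y∈T , y∉⁅0⁆) zir =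
    y∉⁅0⁆ (ZIr-endpoint zir (inj₁ refl) (⁅0⁆⊆T (x∈⁅x⁆ zero)) y∈T)

Z-P≡1 : ∀ m → Z≡ (P (suc m)) 1
Z-P≡1 m =
  (⁅ zero ⁆ , endpoint-ZFS (inj₁ refl) , ∣⁅x⁆∣≡1 {suc m} zero) ,
  λ B zfs → x∈p⇒1≤∣p∣ (proj₂ (ZFS⇒Nonempty {G = P (suc m)} zfs zero))

Zbar-P≡2 : ∀ m → Zbar≡ (P (4 + m)) 2
Zbar-P≡2 m =
  (⁅ v₁ ⁆ ∪ ⁅ v₂ ⁆ , ⁅1⁆∪⁅2⁆-MinimalZFS , ∣⁅x⁆∪⁅y⁆∣≡2 {x = v₁} {v₂} λ ()) ,
  λ B minimal → MinimalZFS-P⇒∣B∣≤2 minimal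
  where
  v₁ v₂ : Fin (4 + m)
  v₁ = suc zero
  v₂ = suc (suc zero)

ZIR-P≡ : ∀ {m} → 4 ≤ m → ZIR≡ (P (suc m)) (m / 2)
ZIR-P≡ {m} 4≤m =
  (oddInner (suc m) , (ZIr-oddInner , oddInner-maximal (s≤s 4≤m)) , ∣oddInner∣ (suc m)) ,
  λ S maximal → ZIr-P⇒∣S∣≤m/2 (proj₁ maximal) 4≤m

proposition3p3 : (∀ n → 1 ≤ n → zir≡ (P n) 1 × Z≡ (P n) 1)
    × (∀ n → 4 ≤ n → Zbar≡ (P n) 2)
    × (∀ n → 5 ≤ n → ZIR≡ (P n) ((n ∸ 1) / 2))
proposition3p3 =
  (λ { (suc m) _ → zir-P≡1 m , Z-P≡1 m }) ,
  (λ { (suc (suc (suc (suc m)))) (s≤s (s≤s (s≤s (s≤s _)))) → Zbar-P≡2 m }) ,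
  (λ { (suc m) (s≤s 4≤m) → ZIR-P≡ 4≤m })
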